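{- Let $\lambda>1$ and let $L(0,n-1)$ be a path with thresholds $t(0)=t(n-1)=1$ and $t(i)\in\{1,2\}$ for $1\le i\le n-2$. Suppose $t(0)=t(1)=\dots=t(j-1)=1$ and $L(j,j+3)$ is a 2-path. Then $$OPT(0,n-1)=1+\min\Big\{OPT(0,j,\overset{1}{\rightarrow})+OPT(\overset{2}{\leftarrow},j+3,n-1),\ OPT(0,j,\overset{2}{\rightarrow})+OPT(\overset{1}{\leftarrow},j+3,n-1)\Big\}.$$
   Context: $L(0,n-1)$ is the path with nodes $0,\dots,n-1$ and edges $\{i,i+1\}$; $L(j,k)$ is the subpath induced by $j,\dots,k$, with the original thresholds. $L(j,k)$ with $j+1\le k-1$ is a 2-path if $t(j+1)=\dots=t(k-1)=2$ and $t(j)=t(k)=1$. Incentives $p$ satisfy $0\le p(i)\le t(i)$, the influence process is $\mathsf{Influenced}[p,0]=\{v:p(v)=t(v)\}$, $\mathsf{Influenced}[p,\ell]=\mathsf{Influenced}[p,\ell-1]\cup\{v:|N(v)\cap\mathsf{Influenced}[p,\ell-1]|\ge t(v)-p(v)\}$, and the TBI problem asks for incentives of minimum total cost influencing all nodes within $\lambda$ rounds. $OPT(0,n-1)$ is the optimal TBI cost on $L(0,n-1)$. $OPT(j,k,\overset{\ell}{\rightarrow})$ is the optimal TBI cost on $L(j,k)$ (process run on $L(j,k)$ alone) under the additional condition that node $k$ is influenced by round $\lambda-\ell$ without getting influence from node $k+1$; $OPT(\overset{\ell}{\leftarrow},j,k)$ is the optimal TBI cost on $L(j,k)$ under the additional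 condition that node $j$ is influenced by round $\lambda-\ell$ without getting influence from node $j-1$. -}

module Defs where

open import Data.Nat using (ℕ; zero; suc; _+_; _∸_; _≤_; _<_; _≤?_; _<?_; _≟_)
open import Data.Bool using (Bool; true; false; _∨_; if_then_else_)
open import Data.List using (List; map; upTo)
open import Data.Nat.ListAction using (sum)
open import Data.Product using (Σ; _×_)
open import Relation.Nullary.Decidable using (⌊_⌋)
open import Relation.Binary.PropositionalEquality using (_≡_)

-- Nodes are natural numbers; thresholds t and incentives p are functions ℕ → ℕ
-- (only their values on the relevant node range matter).

b2n : Bool → ℕ
b2n true  = 1
b2n false = 0

-- Influenced a b t p ℓ v : is node v in Influenced[p,ℓ] for the influence
-- process run on the subpath L(a,b) alone (nodes a..b, edges {i,i+1}),
-- with thresholds t and incentives p.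
mutual
  influenced : (a b : ℕ) (t p : ℕ → ℕ) → ℕ → ℕ → Bool
  influenced a b t p zero v = ⌊ p v ≟ t v ⌋
  influenced a b t p (suc ℓ) v =
    influenced a b t p ℓ v ∨ ⌊ t v ∸ p v ≤? nbCount a b t p ℓ v ⌋

  nbCount : (a b : ℕ) (t p : ℕ → ℕ) → ℕ → ℕ → ℕ
  nbCount a b t p ℓ v =
    (if ⌊ a <? v ⌋ then b2n (influenced a b t p ℓ (v ∸ 1)) else 0)
    + (if ⌊ v <? b ⌋ then b2n (influenced a b t p ℓ (suc v)) else 0)

range : ℕ → ℕ → List ℕ
range a b = map (a +_) (upTo (suc b ∸ a))

cost : (a b : ℕ) → (ℕ → ℕ) → ℕ
cost a b p = sum (map p (range a b))

-- p is a TBI solution on L(a,b) with time bound T (= λ):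
-- 0 ≤ p(i) ≤ t(i) on the path, and all nodes influenced by round T.
Feasible : (T a b : ℕ) (t : ℕ → ℕ) → (ℕ → ℕ) → Set
Feasible T a b t p =
  (∀ i → a ≤ i → i ≤ b → p i ≤ t i)
  × (∀ v → a ≤ v → v ≤ b → influenced a b t p T v ≡ true)

-- additionally node b is influenced by round T ∸ ℓ (process on L(a,b) alone,
-- so without influence from node b+1)
FeasibleR : (T ℓ a b : ℕ) (t : ℕ → ℕ) → (ℕ → ℕ) → Set
FeasibleR T ℓ a b t p = Feasible T a b t p × influenced a b t p (T ∸ ℓ) b ≡ true

-- additionally node a is influenced by round T ∸ ℓ (without influence from a-1)
FeasibleL : (T ℓ a b : ℕ) (t : ℕ → ℕ) → (ℕ → ℕ) → Set
FeasibleL T ℓ a b t p = Feasible T a b t p × influenced a b t p (T ∸ ℓ) a ≡ true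

IsOpt : ((ℕ → ℕ) → Set) → ((ℕ → ℕ) → ℕ) → ℕ → Set
IsOpt F cst c = Σ (ℕ → ℕ) (λ p → F p × cst p ≡ c) × (∀ p → F p → c ≤ cst p)

OPT : (T a b : ℕ) (t : ℕ → ℕ) → ℕ → Set
OPT T a b t = IsOpt (Feasible T a b t) (cost a b)

OPT→ : (T a b ℓ : ℕ) (t : ℕ → ℕ) → ℕ → Set
OPT→ T a b ℓ t = IsOpt (FeasibleR T ℓ a b t) (cost a b)

OPT← : (T ℓ a b : ℕ) (t : ℕ → ℕ) → ℕ → Set
OPT← T ℓ a b t = IsOpt (FeasibleL T ℓ a b t) (cost a b)

module Submission where

open import Defs
open import Algebra.Properties.CommutativeSemigroup using (x∙yz≈y∙xz)
open import Data.Bool using (Bool; true; false; if_then_else_)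
import Data.Bool.Properties as Bool
open import Data.Empty using (⊥; ⊥-elim)
open import Data.List using (applyUpTo; upTo)
open import Data.List.Properties using (map-∘; map-upTo)
open import Data.Nat
open import Data.Nat.ListAction using (sum)
open import Data.Nat.Properties
open import Data.Nat.Tactic.RingSolver using (solve-∀)
open import Data.Product using (_×_; _,_; proj₁; proj₂; ∃-syntax; Σ-syntax)
open import Data.Sum using (_⊎_; inj₁; inj₂; [_,_]; map₂; swap)
open import Function using (_∘_; id)
open import Relation.Binary.PropositionalEquality hiding ([_])
open import Relation.Nullary using (¬_; Dec; yes; no; contradiction)
open import Relation.Nullary.Decidable using (⌊_⌋)

-- Let q be optimal on L(0,n-1), with incentives x, y on the threshold-2 nodes j+1, j+2. Restricted to
-- L(0,j) or L(j+3,n-1), q is a solution of the corresponding one-sided problem whenever the endpoint of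
-- that side is influenced no later than its neighbouring 2-node, and raising the endpoint's incentive to
-- its threshold 1 makes any side a solution at extra cost 1. Since x = y = 0 deadlocks the 2-path, a
-- case analysis on (x, y), tracking which side enters the 2-path and how early, bounds cost(q) below by
-- 1 + min(a + b, c + d). Conversely, joining optimal one-sided solutions with incentives (0, 1) or
-- (1, 0) on j+1, j+2 attains this bound.

sum-applyUpTo-cong : ∀ {f g : ℕ → ℕ} n → (∀ i → i < n → f i ≡ g i) →
                     sum (applyUpTo f n) ≡ sum (applyUpTo g n)
sum-applyUpTo-cong zero    _   = refl
sum-applyUpTo-cong (suc n) f≡g =
  cong₂ _+_ (f≡g 0 z<s) (sum-applyUpTo-cong n (λ i i<n → f≡g (suc i) (s<s i<n)))

sum-applyUpTo-mono : ∀ {f g : ℕ → ℕ} n → (∀ i → f i ≤ g i) →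
                     sum (applyUpTo f n) ≤ sum (applyUpTo g n)
sum-applyUpTo-mono zero    _   = z≤n
sum-applyUpTo-mono (suc n) f≤g = +-mono-≤ (f≤g 0) (sum-applyUpTo-mono n (f≤g ∘ suc))

sum-applyUpTo-+ : ∀ (f : ℕ → ℕ) m n →
  sum (applyUpTo f (m + n)) ≡ sum (applyUpTo f m) + sum (applyUpTo (λ i → f (m + i)) n)
sum-applyUpTo-+ f zero    n = refl
sum-applyUpTo-+ f (suc m) n =
  trans (cong (f 0 +_) (sum-applyUpTo-+ (f ∘ suc) m n)) (sym (+-assoc (f 0) _ _))

sum-applyUpTo-raise : ∀ {f g : ℕ → ℕ} {x k} n → (∀ i → i ≢ x → g i ≤ f i) → g x ≤ k →
                      sum (applyUpTo g n) ≤ k + sum (applyUpTo f n)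
sum-applyUpTo-raise zero _ _ = z≤n
sum-applyUpTo-raise {f} {g} {zero} {k} (suc n) g≤f gx≤k = begin
  g 0 + sum (applyUpTo (g ∘ suc) n)        ≤⟨ +-mono-≤ gx≤k (sum-applyUpTo-mono n rest) ⟩
  k + sum (applyUpTo (f ∘ suc) n)          ≤⟨ +-monoʳ-≤ k (m≤n+m _ (f 0)) ⟩
  k + (f 0 + sum (applyUpTo (f ∘ suc) n))  ∎
  where
  open ≤-Reasoning
  rest : ∀ i → g (suc i) ≤ f (suc i)
  rest i = g≤f (suc i) λ ()
sum-applyUpTo-raise {f} {g} {suc x} {k} (suc n) g≤f gx≤k = begin
  g 0 + sum (applyUpTo (g ∘ suc) n)        ≤⟨ +-mono-≤ (g≤f 0 λ ()) rest ⟩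
  f 0 + (k + sum (applyUpTo (f ∘ suc) n))  ≡⟨ x∙yz≈y∙xz +-commutativeSemigroup (f 0) k _ ⟩
  k + (f 0 + sum (applyUpTo (f ∘ suc) n))  ∎
  where
  open ≤-Reasoning
  rest : sum (applyUpTo (g ∘ suc) n) ≤ k + sum (applyUpTo (f ∘ suc) n)
  rest = sum-applyUpTo-raise n (λ i i≢x → g≤f (suc i) (i≢x ∘ suc-injective)) gx≤k

cost≡sum : ∀ a b p → cost a b p ≡ sum (applyUpTo (λ i → p (a + i)) (suc b ∸ a))
cost≡sum a b p = cong sum (trans (sym (map-∘ (upTo (suc b ∸ a)))) (map-upTo _ (suc b ∸ a)))

<∸⇒+≤ : ∀ {a b i} → i < suc b ∸ a → a + i ≤ b
<∸⇒+≤ {zero}                 i< = ≤-pred i<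
<∸⇒+≤ {suc a} {zero}  {i}    i< = contradiction (subst (i <_) (0∸n≡0 a) i<) λ ()
<∸⇒+≤ {suc a} {suc b}        i< = s≤s (<∸⇒+≤ {a} i<)

cost-cong : ∀ a b {p q} → (∀ v → a ≤ v → v ≤ b → p v ≡ q v) → cost a b p ≡ cost a b q
cost-cong a b {p} {q} p≡q = begin
  cost a b p                                     ≡⟨ cost≡sum a b p ⟩
  sum (applyUpTo (λ i → p (a + i)) (suc b ∸ a))  ≡⟨ sum-applyUpTo-cong (suc b ∸ a) pointwise ⟩
  sum (applyUpTo (λ i → q (a + i)) (suc b ∸ a))  ≡⟨ cost≡sum a b q ⟨
  cost a b q                                     ∎
  where
  open ≡-Reasoning
  pointwise : ∀ i → i < suc b ∸ a → p (a + i) ≡ q (a + i)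
  pointwise i i< = p≡q (a + i) (m≤m+n a i) (<∸⇒+≤ {a} i<)

cost-single : ∀ a p → cost a a p ≡ p a
cost-single a p = begin
  cost a a p                                     ≡⟨ cost≡sum a a p ⟩
  sum (applyUpTo (λ i → p (a + i)) (suc a ∸ a))  ≡⟨ cong (sum ∘ applyUpTo (λ i → p (a + i))) suc-a∸a≡1 ⟩
  p (a + 0) + 0                                  ≡⟨ trans (+-identityʳ _) (cong p (+-identityʳ a)) ⟩
  p a                                            ∎
  where
  open ≡-Reasoning
  suc-a∸a≡1 : suc a ∸ a ≡ 1
  suc-a∸a≡1 = trans (+-∸-assoc 1 (≤-refl {a})) (cong suc (n∸n≡0 a))

cost-split : ∀ {a c b} p → a ≤ c → c < b → cost a b p ≡ cost a c p + cost (suc c) b p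
cost-split {a} {c} {b} p a≤c c<b = begin
  cost a b p                                                     ≡⟨ cost≡sum a b p ⟩
  sum (applyUpTo f (suc b ∸ a))                                  ≡⟨ cong (sum ∘ applyUpTo f) length-split ⟩
  sum (applyUpTo f ((suc c ∸ a) + (b ∸ c)))                      ≡⟨ sum-applyUpTo-+ f (suc c ∸ a) (b ∸ c) ⟩
  sum (applyUpTo f (suc c ∸ a)) + sum (applyUpTo (λ i → f ((suc c ∸ a) + i)) (b ∸ c))
    ≡⟨ cong (sum (applyUpTo f (suc c ∸ a)) +_) (sum-applyUpTo-cong (b ∸ c) (λ i _ → cong p (shift i))) ⟩
  sum (applyUpTo f (suc c ∸ a)) + sum (applyUpTo (λ i → p (suc c + i)) (b ∸ c))
    ≡⟨ cong₂ _+_ (cost≡sum a c p) (cost≡sum (suc c) b p) ⟨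
  cost a c p + cost (suc c) b p                                  ∎
  where
  open ≡-Reasoning
  f : ℕ → ℕ
  f i = p (a + i)
  a≤suc-c : a ≤ suc c
  a≤suc-c = m≤n⇒m≤1+n a≤c
  length-split : suc b ∸ a ≡ (suc c ∸ a) + (b ∸ c)
  length-split = trans (cong (λ k → suc k ∸ a) (sym (m+[n∸m]≡n (<⇒≤ c<b)))) (+-∸-comm (b ∸ c) a≤suc-c)
  shift : ∀ i → a + ((suc c ∸ a) + i) ≡ suc c + i
  shift i = trans (sym (+-assoc a _ i)) (cong (_+ i) (m+[n∸m]≡n a≤suc-c))

cost-uncons : ∀ {a b} p → a < b → cost a b p ≡ p a + cost (suc a) b p
cost-uncons {a} {b} p a<b = trans (cost-split p ≤-refl a<b) (cong (_+ cost (suc a) b p) (cost-single a p))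

cost-around : ∀ {a c b} p → a ≤ c → 3 + c ≤ b →
              cost a b p ≡ cost a c p + (p (1 + c) + (p (2 + c) + cost (3 + c) b p))
cost-around {a} {c} p a≤c c+3≤b =
  trans (cost-split p a≤c (≤-trans (n≤1+n _) (≤-trans (n≤1+n _) c+3≤b)))
        (cong (cost a c p +_) (trans (cost-uncons p (≤-trans (n≤1+n _) c+3≤b))
                                     (cong (p (1 + c) +_) (cost-uncons p c+3≤b))))

_[_]≔_ : (ℕ → ℕ) → ℕ → ℕ → ℕ → ℕ
(p [ x ]≔ k) v with v ≟ x
... | yes _ = k
... | no  _ = p v

[]≔-updates : ∀ p x k → (p [ x ]≔ k) x ≡ k
[]≔-updates p x k with x ≟ x
... | yes _   = refl
... | no  x≢x = contradiction refl x≢x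

[]≔-minimal : ∀ p {x} k {v} → v ≢ x → (p [ x ]≔ k) v ≡ p v
[]≔-minimal p {x} k {v} v≢x with v ≟ x
... | yes v≡x = contradiction v≡x v≢x
... | no  _   = refl

[]≔-increasing : ∀ p {x k} → p x ≤ k → ∀ v → p v ≤ (p [ x ]≔ k) v
[]≔-increasing p {x} px≤k v with v ≟ x
... | yes refl = px≤k
... | no  _    = ≤-refl

[]≔-bounded : ∀ p {r : ℕ → ℕ} {x k} → k ≤ r x → ∀ v → p v ≤ r v → (p [ x ]≔ k) v ≤ r v
[]≔-bounded p {x = x} k≤rx v pv≤rv with v ≟ x
... | yes refl = k≤rx
... | no  _    = pv≤rv

cost-[]≔ : ∀ {a x} b p k → a ≤ x → cost a b (p [ x ]≔ k) ≤ k + cost a b p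
cost-[]≔ {a} {x} b p k a≤x = begin
  cost a b (p [ x ]≔ k)                                     ≡⟨ cost≡sum a b _ ⟩
  sum (applyUpTo (λ i → (p [ x ]≔ k) (a + i)) (suc b ∸ a))
    ≤⟨ sum-applyUpTo-raise (suc b ∸ a) unchanged raised ⟩
  k + sum (applyUpTo (λ i → p (a + i)) (suc b ∸ a))         ≡⟨ cong (k +_) (cost≡sum a b p) ⟨
  k + cost a b p                                            ∎
  where
  open ≤-Reasoning
  unchanged : ∀ i → i ≢ x ∸ a → (p [ x ]≔ k) (a + i) ≤ p (a + i)
  unchanged i i≢ =
    ≤-reflexive ([]≔-minimal p k λ a+i≡x → i≢ (trans (sym (m+n∸m≡n a i)) (cong (_∸ a) a+i≡x)))
  raised : (p [ x ]≔ k) (a + (x ∸ a)) ≤ k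
  raised = ≤-reflexive (trans (cong (p [ x ]≔ k) (m+[n∸m]≡n a≤x)) ([]≔-updates p x k))

_⟨_⟩_ : (ℕ → ℕ) → ℕ → (ℕ → ℕ) → ℕ → ℕ
(p ⟨ c ⟩ q) v with v ≤? c
... | yes _ = p v
... | no  _ = q v

⟨⟩-left : ∀ p {c} q {v} → v ≤ c → (p ⟨ c ⟩ q) v ≡ p v
⟨⟩-left p {c} q {v} v≤c with v ≤? c
... | yes _   = refl
... | no  v≰c = contradiction v≤c v≰c

⟨⟩-right : ∀ p {c} q {v} → c < v → (p ⟨ c ⟩ q) v ≡ q v
⟨⟩-right p {c} q {v} c<v with v ≤? c
... | yes v≤c = contradiction v≤c (<⇒≱ c<v)
... | no  _   = refl

Stable : (ℕ → Set) → Set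
Stable P = ∀ ℓ → P ℓ → P (suc ℓ)

stable-≤ : ∀ {P : ℕ → Set} → Stable P → ∀ {m k} → m ≤ k → P m → P k
stable-≤ {P} P↑ = go ∘ ≤⇒≤′
  where
  go : ∀ {m k} → m ≤′ k → P m → P k
  go ≤′-refl       = id
  go (≤′-step m≤k) = P↑ _ ∘ go m≤k

module _ {P Q : ℕ → Set} (P↑ : Stable P) (Q↑ : Stable Q) where

  ⊎-stable : Stable (λ ℓ → P ℓ ⊎ Q ℓ)
  ⊎-stable ℓ = [ inj₁ ∘ P↑ ℓ , inj₂ ∘ Q↑ ℓ ]

  ×-stable : Stable (λ ℓ → P ℓ × Q ℓ)
  ×-stable ℓ (p , q) = P↑ ℓ p , Q↑ ℓ q

never : ∀ {W : ℕ → Set} → ¬ W 0 → (∀ ℓ → W (suc ℓ) → W ℓ) → ∀ ℓ → ¬ W ℓ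
never ¬W₀ step zero    = ¬W₀
never ¬W₀ step (suc ℓ) = never ¬W₀ step ℓ ∘ step ℓ

module _ {W Q : ℕ → Set} (¬W₀ : ¬ W 0) (Q↑ : Stable Q) where

  preceded-strictly : (∀ ℓ → W (suc ℓ) → W ℓ ⊎ Q ℓ) → ∀ ℓ → W (suc ℓ) → Q ℓ
  preceded-strictly step zero    = [ ⊥-elim ∘ ¬W₀ , id ] ∘ step zero
  preceded-strictly step (suc ℓ) = [ Q↑ ℓ ∘ preceded-strictly step ℓ , id ] ∘ step (suc ℓ)

  preceded : (∀ ℓ → W (suc ℓ) → Q ℓ) → ∀ ℓ → W ℓ → Q ℓ
  preceded before zero    = ⊥-elim ∘ ¬W₀
  preceded before (suc ℓ) = Q↑ ℓ ∘ before ℓ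

precedes : ∀ {W Q : ℕ → Set} {s} → Stable W → Stable Q → Q s → ¬ W s → ∀ ℓ → W ℓ → Q ℓ
precedes {s = s} W↑ Q↑ q ¬w ℓ w with ℓ ≤? s
... | yes ℓ≤s = contradiction (stable-≤ W↑ ℓ≤s w) ¬w
... | no  ℓ≰s = stable-≤ Q↑ (<⇒≤ (≰⇒> ℓ≰s)) q

module _ {W₁ W₂ Q₁ Q₂ : ℕ → Set} (W₁? : ∀ ℓ → Dec (W₁ ℓ)) (W₂? : ∀ ℓ → Dec (W₂ ℓ))
         (¬W₁₀ : ¬ W₁ 0) (¬W₂₀ : ¬ W₂ 0)
         (step₁ : ∀ ℓ → W₁ (suc ℓ) → Q₁ ℓ ⊎ W₂ ℓ) (step₂ : ∀ ℓ → W₂ (suc ℓ) → Q₂ ℓ ⊎ W₁ ℓ) where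

  private
    earlier : ∀ {ℓ} {R : ℕ → Set} → ∃[ s ] s < ℓ × R s → ∃[ s ] s < suc ℓ × R s
    earlier (s , s<ℓ , r) = s , m<n⇒m<1+n s<ℓ , r

  first-cause : ∀ ℓ → W₁ ℓ ⊎ W₂ ℓ → ∃[ s ] s < ℓ × (Q₁ s × ¬ W₁ s ⊎ Q₂ s × ¬ W₂ s)
  first-cause zero = [ ⊥-elim ∘ ¬W₁₀ , ⊥-elim ∘ ¬W₂₀ ]
  first-cause (suc ℓ) (inj₁ w₁) with W₁? ℓ | step₁ ℓ w₁
  ... | yes w₁′ | _       = earlier (first-cause ℓ (inj₁ w₁′))
  ... | no  ¬w₁ | inj₁ q₁ = ℓ , n<1+n ℓ , inj₁ (q₁ , ¬w₁)
  ... | no  _   | inj₂ w₂ = earlier (first-cause ℓ (inj₂ w₂))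
  first-cause (suc ℓ) (inj₂ w₂) with W₂? ℓ | step₂ ℓ w₂
  ... | yes w₂′ | _       = earlier (first-cause ℓ (inj₂ w₂′))
  ... | no  ¬w₂ | inj₁ q₂ = ℓ , n<1+n ℓ , inj₂ (q₂ , ¬w₂)
  ... | no  _   | inj₂ w₁ = earlier (first-cause ℓ (inj₁ w₁))

-- Round and node are swapped relative to influenced, so that Influenced a b t p v is a property of rounds.
Influenced : (a b : ℕ) (t p : ℕ → ℕ) → ℕ → ℕ → Set
Influenced a b t p v ℓ = influenced a b t p ℓ v ≡ true

1≤b2n+b2n⁻ : ∀ x y → 1 ≤ b2n x + b2n y → x ≡ true ⊎ y ≡ true
1≤b2n+b2n⁻ true  _    _ = inj₁ refl
1≤b2n+b2n⁻ false true _ = inj₂ refl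

2≤b2n+b2n⁻ : ∀ x y → 2 ≤ b2n x + b2n y → x ≡ true × y ≡ true
2≤b2n+b2n⁻ true  true  _        = refl , refl
2≤b2n+b2n⁻ true  false (s≤s ())
2≤b2n+b2n⁻ false true  (s≤s ())

1≤b2n+b2n⁺ : ∀ {x y} → x ≡ true ⊎ y ≡ true → 1 ≤ b2n x + b2n y
1≤b2n+b2n⁺ {true}          _        = s≤s z≤n
1≤b2n+b2n⁺ {false} {true}  _        = s≤s z≤n
1≤b2n+b2n⁺ {false} {false} (inj₁ ())
1≤b2n+b2n⁺ {false} {false} (inj₂ ())

2≤b2n+b2n⁺ : ∀ {x y} → x ≡ true → y ≡ true → 2 ≤ b2n x + b2n y
2≤b2n+b2n⁺ refl refl = s≤s (s≤s z≤n)

module Process (a b : ℕ) (t p : ℕ → ℕ) where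

  private
    I : ℕ → ℕ → Set
    I = Influenced a b t p

  influenced? : ∀ v ℓ → Dec (I v ℓ)
  influenced? v ℓ = influenced a b t p ℓ v Bool.≟ true

  influenced-stable : ∀ v → Stable (I v)
  influenced-stable v ℓ h rewrite h = refl

  influenced-initially : ∀ {v} → p v ≡ t v → I v 0
  influenced-initially {v} p≡t with p v ≟ t v
  ... | yes _   = refl
  ... | no  p≢t = contradiction p≡t p≢t

  influenced-initially⁻ : ∀ {v} → I v 0 → p v ≡ t v
  influenced-initially⁻ {v} h with p v ≟ t v
  ... | yes p≡t = p≡t

  uninfluenced-initially : ∀ {v} → 1 ≤ t v ∸ p v → ¬ I v 0
  uninfluenced-initially {v} demand h =
    <⇒≱ demand (≤-reflexive (trans (cong (t v ∸_) (influenced-initially⁻ h)) (n∸n≡0 (t v))))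

  influenced-suc⁻ : ∀ v ℓ → I v (suc ℓ) → I v ℓ ⊎ t v ∸ p v ≤ nbCount a b t p ℓ v
  influenced-suc⁻ v ℓ h with influenced a b t p ℓ v | t v ∸ p v ≤? nbCount a b t p ℓ v
  ... | true  | _      = inj₁ refl
  ... | false | yes le = inj₂ le

  influenced-suc⁺ : ∀ v ℓ → t v ∸ p v ≤ nbCount a b t p ℓ v → I v (suc ℓ)
  influenced-suc⁺ v ℓ le with influenced a b t p ℓ v | t v ∸ p v ≤? nbCount a b t p ℓ v
  ... | true  | _      = refl
  ... | false | yes _  = refl
  ... | false | no ¬le = contradiction le ¬le

  module Interior {v} (a<v : a < v) (v<b : v < b) where

    private
      Neighbours : ℕ → ℕ
      Neighbours ℓ = b2n (influenced a b t p ℓ (v ∸ 1)) + b2n (influenced a b t p ℓ (suc v))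

      nbCount-interior : ∀ ℓ → nbCount a b t p ℓ v ≡ Neighbours ℓ
      nbCount-interior ℓ with a <? v | v <? b
      ... | yes _   | yes _   = refl
      ... | no ¬a<v | _       = contradiction a<v ¬a<v
      ... | yes _   | no ¬v<b = contradiction v<b ¬v<b

      influenced-suc⁻-interior : ∀ ℓ → I v (suc ℓ) → I v ℓ ⊎ t v ∸ p v ≤ Neighbours ℓ
      influenced-suc⁻-interior ℓ = map₂ (subst (t v ∸ p v ≤_) (nbCount-interior ℓ)) ∘ influenced-suc⁻ v ℓ

      influenced-suc⁺-interior : ∀ ℓ → t v ∸ p v ≤ Neighbours ℓ → I v (suc ℓ)
      influenced-suc⁺-interior ℓ = influenced-suc⁺ v ℓ ∘ subst (t v ∸ p v ≤_) (sym (nbCount-interior ℓ))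

    waits-for-one : 1 ≤ t v ∸ p v → ∀ ℓ → I v (suc ℓ) → I (v ∸ 1) ℓ ⊎ I (suc v) ℓ
    waits-for-one demand =
      preceded-strictly (uninfluenced-initially demand)
        (⊎-stable (influenced-stable (v ∸ 1)) (influenced-stable (suc v)))
        (λ ℓ → map₂ (1≤b2n+b2n⁻ _ _ ∘ ≤-trans demand) ∘ influenced-suc⁻-interior ℓ)

    waits-for-both : 2 ≤ t v ∸ p v → ∀ ℓ → I v (suc ℓ) → I (v ∸ 1) ℓ × I (suc v) ℓ
    waits-for-both demand =
      preceded-strictly (uninfluenced-initially (≤-trans (s≤s z≤n) demand))
        (×-stable (influenced-stable (v ∸ 1)) (influenced-stable (suc v)))
        (λ ℓ → map₂ (2≤b2n+b2n⁻ _ _ ∘ ≤-trans demand) ∘ influenced-suc⁻-interior ℓ)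

    needs-both : 2 ≤ t v ∸ p v → ∀ ℓ → I v ℓ → I (v ∸ 1) ℓ × I (suc v) ℓ
    needs-both demand =
      preceded (uninfluenced-initially (≤-trans (s≤s z≤n) demand))
        (×-stable (influenced-stable (v ∸ 1)) (influenced-stable (suc v)))
        (waits-for-both demand)

    one-neighbour-suffices : t v ∸ p v ≤ 1 → ∀ ℓ → I (v ∸ 1) ℓ ⊎ I (suc v) ℓ → I v (suc ℓ)
    one-neighbour-suffices demand ℓ = influenced-suc⁺-interior ℓ ∘ ≤-trans demand ∘ 1≤b2n+b2n⁺

    both-neighbours-suffice : t v ∸ p v ≤ 2 → ∀ ℓ → I (v ∸ 1) ℓ → I (suc v) ℓ → I v (suc ℓ)
    both-neighbours-suffice demand ℓ h₁ h₂ =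
      influenced-suc⁺-interior ℓ (≤-trans demand (2≤b2n+b2n⁺ h₁ h₂))

guarded-b2n-mono : ∀ {A B : Set} (A? : Dec A) (B? : Dec B) {x y : Bool} →
  (A → x ≡ true → B × y ≡ true) →
  (if ⌊ A? ⌋ then b2n x else 0) ≤ (if ⌊ B? ⌋ then b2n y else 0)
guarded-b2n-mono (no _)  _  _           = z≤n
guarded-b2n-mono (yes _) _  {false} _   = z≤n
guarded-b2n-mono (yes a) B? {true}  A⇒B with A⇒B a refl
... | b , refl with B?
...   | yes _ = ≤-refl
...   | no ¬b = contradiction b ¬b

module _ (t : ℕ → ℕ) (a₁ b₁ : ℕ) (p₁ : ℕ → ℕ) (a₂ b₂ : ℕ) (p₂ : ℕ → ℕ) {c d : ℕ} where

  private
    I₁ I₂ : ℕ → ℕ → Set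
    I₁ = Influenced a₁ b₁ t p₁
    I₂ = Influenced a₂ b₂ t p₂
    module P₁ = Process a₁ b₁ t p₁
    module P₂ = Process a₂ b₂ t p₂

  influence-transfer :
    a₂ ≤ c → d ≤ b₂ →
    (∀ v → c ≤ v → v ≤ d → p₁ v ≤ p₂ v) →
    (∀ v → c ≤ v → v ≤ d → p₂ v ≤ t v) →
    (a₁ < c → ∀ ℓ → I₁ (c ∸ 1) ℓ → I₁ c ℓ ⊎ I₂ c ℓ) →
    (d < b₁ → ∀ ℓ → I₁ (suc d) ℓ → I₁ d ℓ ⊎ I₂ d ℓ) →
    ∀ ℓ v → c ≤ v → v ≤ d → I₁ v ℓ → I₂ v ℓ
  influence-transfer a₂≤c d≤b₂ p₁≤p₂ p₂≤t enter-left enter-right = transfer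
    where
    transfer : ∀ ℓ v → c ≤ v → v ≤ d → I₁ v ℓ → I₂ v ℓ
    transfer zero v c≤v v≤d h =
      P₂.influenced-initially
        (≤-antisym (p₂≤t v c≤v v≤d) (subst (_≤ p₂ v) (P₁.influenced-initially⁻ h) (p₁≤p₂ v c≤v v≤d)))
    transfer (suc ℓ) v c≤v v≤d h with P₁.influenced? v ℓ | P₂.influenced? v ℓ
    ... | yes h₁ | _      = P₂.influenced-stable v ℓ (transfer ℓ v c≤v v≤d h₁)
    ... | no _   | yes h₂ = P₂.influenced-stable v ℓ h₂
    ... | no ¬h₁ | no ¬h₂ = P₂.influenced-suc⁺ v ℓ (begin
          t v ∸ p₂ v              ≤⟨ ∸-monoʳ-≤ (t v) (p₁≤p₂ v c≤v v≤d) ⟩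
          t v ∸ p₁ v              ≤⟨ [ (λ h₁ → contradiction h₁ ¬h₁) , id ] (P₁.influenced-suc⁻ v ℓ h) ⟩
          nbCount a₁ b₁ t p₁ ℓ v  ≤⟨ +-mono-≤ (guarded-b2n-mono (a₁ <? v) (a₂ <? v) from-left)
                                              (guarded-b2n-mono (v <? b₁) (v <? b₂) from-right) ⟩
          nbCount a₂ b₂ t p₂ ℓ v  ∎)
      where
      open ≤-Reasoning
      neither : I₁ v ℓ ⊎ I₂ v ℓ → ∀ {A : Set} → A
      neither h = contradiction h [ ¬h₁ , ¬h₂ ]
      from-left : a₁ < v → I₁ (v ∸ 1) ℓ → a₂ < v × I₂ (v ∸ 1) ℓ
      from-left a₁<v h′ with m≤n⇒m<n∨m≡n c≤v
      ... | inj₁ c<v  = ≤-<-trans a₂≤c c<v , transfer ℓ (v ∸ 1) (<⇒≤pred c<v) (≤-trans pred[n]≤n v≤d) h′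
      ... | inj₂ refl = neither (enter-left a₁<v ℓ h′)
      from-right : v < b₁ → I₁ (suc v) ℓ → v < b₂ × I₂ (suc v) ℓ
      from-right v<b₁ h′ with m≤n⇒m<n∨m≡n v≤d
      ... | inj₁ v<d  = <-≤-trans v<d d≤b₂ , transfer ℓ (suc v) (m≤n⇒m≤1+n c≤v) v<d h′
      ... | inj₂ refl = neither (enter-right v<b₁ ℓ h′)

module _ (t : ℕ → ℕ) {a b : ℕ} {p₁ p₂ : ℕ → ℕ} where

  private
    irrefl : ∀ {n} {A : Set} → n < n → A
    irrefl n<n = contradiction n<n (<-irrefl refl)

  embedding : ∀ {a′ b′} → a′ ≤ a → b ≤ b′ →
    (∀ v → a ≤ v → v ≤ b → p₁ v ≤ p₂ v) → (∀ v → a ≤ v → v ≤ b → p₂ v ≤ t v) →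
    ∀ ℓ v → a ≤ v → v ≤ b → Influenced a b t p₁ v ℓ → Influenced a′ b′ t p₂ v ℓ
  embedding {a′} {b′} a′≤a b≤b′ p₁≤p₂ p₂≤t =
    influence-transfer t a b p₁ a′ b′ p₂ a′≤a b≤b′ p₁≤p₂ p₂≤t irrefl irrefl

  restriction-left : ∀ {c} →
    (∀ v → a ≤ v → v ≤ c → p₁ v ≤ p₂ v) → (∀ v → a ≤ v → v ≤ c → p₂ v ≤ t v) →
    (∀ ℓ → Influenced a b t p₁ (suc c) ℓ → Influenced a b t p₁ c ℓ ⊎ Influenced a c t p₂ c ℓ) →
    ∀ ℓ v → a ≤ v → v ≤ c → Influenced a b t p₁ v ℓ → Influenced a c t p₂ v ℓ
  restriction-left {c} p₁≤p₂ p₂≤t enter =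
    influence-transfer t a b p₁ a c p₂ ≤-refl ≤-refl p₁≤p₂ p₂≤t irrefl (λ _ → enter)

  restriction-right : ∀ {c} →
    (∀ v → c ≤ v → v ≤ b → p₁ v ≤ p₂ v) → (∀ v → c ≤ v → v ≤ b → p₂ v ≤ t v) →
    (∀ ℓ → Influenced a b t p₁ (c ∸ 1) ℓ → Influenced a b t p₁ c ℓ ⊎ Influenced c b t p₂ c ℓ) →
    ∀ ℓ v → c ≤ v → v ≤ b → Influenced a b t p₁ v ℓ → Influenced c b t p₂ v ℓ
  restriction-right {c} p₁≤p₂ p₂≤t enter =
    influence-transfer t a b p₁ c b p₂ ≤-refl ≤-refl p₁≤p₂ p₂≤t (λ _ → enter) irrefl

sum-bound : ∀ {A B} e₁ e₂ f x y g → A ≤ e₁ + f → B ≤ e₂ + g → e₁ + e₂ < x + y →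
            suc (A + B) ≤ f + (x + (y + g))
sum-bound {A} {B} e₁ e₂ f x y g A≤ B≤ e<xy = begin
  suc (A + B)                ≤⟨ s≤s (+-mono-≤ A≤ B≤) ⟩
  suc ((e₁ + f) + (e₂ + g))  ≡⟨ regroup₁ e₁ e₂ f g ⟩
  suc (e₁ + e₂) + (f + g)    ≤⟨ +-monoˡ-≤ (f + g) e<xy ⟩
  (x + y) + (f + g)          ≡⟨ regroup₂ x y f g ⟩
  f + (x + (y + g))          ∎
  where
  open ≤-Reasoning
  regroup₁ : ∀ e₁ e₂ f g → suc ((e₁ + f) + (e₂ + g)) ≡ suc (e₁ + e₂) + (f + g)
  regroup₁ = solve-∀
  regroup₂ : ∀ x y f g → (x + y) + (f + g) ≡ f + (x + (y + g))
  regroup₂ = solve-∀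

module LowerBound {T′ e j : ℕ} {t q : ℕ → ℕ}
  (t[j]≡1 : t j ≡ 1) (t[j+1]≡2 : t (1 + j) ≡ 2) (t[j+2]≡2 : t (2 + j) ≡ 2) (t[j+3]≡1 : t (3 + j) ≡ 1)
  (j+3≤e : 3 + j ≤ e) (q-feasible : Feasible (2 + T′) 0 e t q) where

  T j+1 j+2 j+3 : ℕ
  T   = 2 + T′
  j+1 = 1 + j
  j+2 = 2 + j
  j+3 = 3 + j

  F : ℕ → ℕ → Set
  F = Influenced 0 e t q

  open Process 0 e t q

  j+2<e : j+2 < e
  j+2<e = j+3≤e

  j+1<e : j+1 < e
  j+1<e = ≤-trans (n≤1+n _) j+3≤e

  j≤e : j ≤ e
  j≤e = ≤-trans (n≤1+n j) (<⇒≤ j+1<e)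

  q≤t : ∀ v → v ≤ e → q v ≤ t v
  q≤t v = proj₁ q-feasible v z≤n

  influenced-at-T : ∀ v → v ≤ e → F v T
  influenced-at-T v = proj₂ q-feasible v z≤n

  module Left {q′ : ℕ → ℕ} (q≤q′ : ∀ v → v ≤ j → q v ≤ q′ v) (q′≤t : ∀ v → v ≤ j → q′ v ≤ t v)
              (enter : ∀ ℓ → F j+1 ℓ → F j ℓ ⊎ Influenced 0 j t q′ j ℓ) where

    transfer : ∀ ℓ v → v ≤ j → F v ℓ → Influenced 0 j t q′ v ℓ
    transfer ℓ v = restriction-left t (λ v _ → q≤q′ v) (λ v _ → q′≤t v) enter ℓ v z≤n

    feasible : ∀ ℓ → Influenced 0 j t q′ j (T ∸ ℓ) → FeasibleR T ℓ 0 j t q′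
    feasible ℓ h =
      ((λ v _ → q′≤t v) , λ v _ v≤j → transfer T v v≤j (influenced-at-T v (≤-trans v≤j j≤e))) , h

  module Right {q′ : ℕ → ℕ}
               (q≤q′ : ∀ v → j+3 ≤ v → v ≤ e → q v ≤ q′ v) (q′≤t : ∀ v → j+3 ≤ v → v ≤ e → q′ v ≤ t v)
               (enter : ∀ ℓ → F j+2 ℓ → F j+3 ℓ ⊎ Influenced j+3 e t q′ j+3 ℓ) where

    transfer : ∀ ℓ v → j+3 ≤ v → v ≤ e → F v ℓ → Influenced j+3 e t q′ v ℓ
    transfer = restriction-right t q≤q′ q′≤t enter

    feasible : ∀ ℓ → Influenced j+3 e t q′ j+3 (T ∸ ℓ) → FeasibleL T ℓ j+3 e t q′
    feasible ℓ h = (q′≤t , λ v j+3≤v v≤e → transfer T v j+3≤v v≤e (influenced-at-T v v≤e)) , h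

  -- Raised to its threshold 1, the endpoint is influenced from round 0 on and needs no help from the 2-path.
  left-raised : ∀ ℓ → FeasibleR T ℓ 0 j t (q [ j ]≔ 1)
  left-raised ℓ = Raised.feasible ℓ (j-always (T ∸ ℓ))
    where
    j-always : ∀ ℓ → Influenced 0 j t (q [ j ]≔ 1) j ℓ
    j-always ℓ = stable-≤ (Process.influenced-stable 0 j t (q [ j ]≔ 1) j) (z≤n {ℓ})
                   (Process.influenced-initially 0 j t (q [ j ]≔ 1) (trans ([]≔-updates q j 1) (sym t[j]≡1)))
    module Raised = Left (λ v _ → []≔-increasing q (≤-trans (q≤t j j≤e) (≤-reflexive t[j]≡1)) v)
                         (λ v v≤j → []≔-bounded q {t} (≤-reflexive (sym t[j]≡1)) v
                                      (q≤t v (≤-trans v≤j j≤e)))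
                         (λ ℓ _ → inj₂ (j-always ℓ))

  right-raised : ∀ ℓ → FeasibleL T ℓ j+3 e t (q [ j+3 ]≔ 1)
  right-raised ℓ = Raised.feasible ℓ (j+3-always (T ∸ ℓ))
    where
    j+3-always : ∀ ℓ → Influenced j+3 e t (q [ j+3 ]≔ 1) j+3 ℓ
    j+3-always ℓ =
      stable-≤ (Process.influenced-stable j+3 e t (q [ j+3 ]≔ 1) j+3) (z≤n {ℓ})
        (Process.influenced-initially j+3 e t (q [ j+3 ]≔ 1) (trans ([]≔-updates q j+3 1) (sym t[j+3]≡1)))
    module Raised = Right (λ v _ _ → []≔-increasing q (≤-trans (q≤t j+3 j+3≤e) (≤-reflexive t[j+3]≡1)) v)
                          (λ v _ v≤e → []≔-bounded q {t} (≤-reflexive (sym t[j+3]≡1)) v (q≤t v v≤e))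
                          (λ ℓ _ → inj₂ (j+3-always ℓ))

  left-restricted : (∀ ℓ → F j+1 ℓ → F j ℓ) → ∀ ℓ → F j (T ∸ ℓ) → FeasibleR T ℓ 0 j t q
  left-restricted j-first ℓ h = Restricted.feasible ℓ (Restricted.transfer (T ∸ ℓ) j ≤-refl h)
    where
    module Restricted = Left (λ _ _ → ≤-refl) (λ v v≤j → q≤t v (≤-trans v≤j j≤e)) (λ ℓ → inj₁ ∘ j-first ℓ)

  right-restricted : (∀ ℓ → F j+2 ℓ → F j+3 ℓ) → ∀ ℓ → F j+3 (T ∸ ℓ) → FeasibleL T ℓ j+3 e t q
  right-restricted j+3-first ℓ h = Restricted.feasible ℓ (Restricted.transfer (T ∸ ℓ) j+3 ≤-refl j+3≤e h)
    where
    module Restricted = Right (λ _ _ _ → ≤-refl) (λ v _ v≤e → q≤t v v≤e) (λ ℓ → inj₁ ∘ j+3-first ℓ)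

  module J₁ = Interior {j+1} (s≤s z≤n) j+1<e
  module J₂ = Interior {j+2} (s≤s z≤n) j+2<e

  demand₁ : ∀ {k} → q j+1 ≡ k → 2 ∸ k ≤ t j+1 ∸ q j+1
  demand₁ q≡k = ≤-reflexive (sym (cong₂ _∸_ t[j+1]≡2 q≡k))

  demand₂ : ∀ {k} → q j+2 ≡ k → 2 ∸ k ≤ t j+2 ∸ q j+2
  demand₂ q≡k = ≤-reflexive (sym (cong₂ _∸_ t[j+2]≡2 q≡k))

  j+1-at-T : F j+1 T
  j+1-at-T = influenced-at-T j+1 (<⇒≤ j+1<e)

  j+2-at-T : F j+2 T
  j+2-at-T = influenced-at-T j+2 (<⇒≤ j+2<e)

  deadlock : q j+1 ≡ 0 → q j+2 ≡ 0 → ⊥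
  deadlock x≡0 y≡0 =
    never {W = λ ℓ → F j+1 ℓ ⊎ F j+2 ℓ}
      [ uninfluenced-initially (≤-trans (s≤s z≤n) (demand₁ x≡0))
      , uninfluenced-initially (≤-trans (s≤s z≤n) (demand₂ y≡0)) ]
      (λ ℓ → [ inj₂ ∘ proj₂ ∘ J₁.waits-for-both (demand₁ x≡0) ℓ
             , inj₁ ∘ proj₁ ∘ J₂.waits-for-both (demand₂ y≡0) ℓ ])
      T (inj₁ j+1-at-T)

  q[j+1]≡0⇒left-feasible₁ : q j+1 ≡ 0 → FeasibleR T 1 0 j t q
  q[j+1]≡0⇒left-feasible₁ x≡0 =
    left-restricted (λ ℓ → proj₁ ∘ J₁.needs-both (demand₁ x≡0) ℓ) 1
      (proj₁ (J₁.waits-for-both (demand₁ x≡0) (suc T′) j+1-at-T))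

  q[j+2]≡0⇒right-feasible₁ : q j+2 ≡ 0 → FeasibleL T 1 j+3 e t q
  q[j+2]≡0⇒right-feasible₁ y≡0 =
    right-restricted (λ ℓ → proj₂ ∘ J₂.needs-both (demand₂ y≡0) ℓ) 1
      (proj₂ (J₂.waits-for-both (demand₂ y≡0) (suc T′) j+2-at-T))

  q[j+2]≡0⇒left-feasible₂ : q j+1 ≡ 1 → q j+2 ≡ 0 → FeasibleR T 2 0 j t q
  q[j+2]≡0⇒left-feasible₂ x≡1 y≡0 =
    left-restricted j-first 2 (j-before T′ (proj₁ (J₂.waits-for-both (demand₂ y≡0) (suc T′) j+2-at-T)))
    where
    j-before : ∀ ℓ → F j+1 (suc ℓ) → F j ℓ
    j-before = preceded-strictly (uninfluenced-initially (demand₁ x≡1)) (influenced-stable j)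
                 (λ ℓ → [ inj₂ , inj₁ ∘ proj₁ ∘ J₂.needs-both (demand₂ y≡0) ℓ ]
                        ∘ J₁.waits-for-one (demand₁ x≡1) ℓ)
    j-first : ∀ ℓ → F j+1 ℓ → F j ℓ
    j-first = preceded (uninfluenced-initially (demand₁ x≡1)) (influenced-stable j) j-before

  q[j+1]≡0⇒right-feasible₂ : q j+1 ≡ 0 → q j+2 ≡ 1 → FeasibleL T 2 j+3 e t q
  q[j+1]≡0⇒right-feasible₂ x≡0 y≡1 =
    right-restricted j+3-first 2 (j+3-before T′ (proj₂ (J₁.waits-for-both (demand₁ x≡0) (suc T′) j+1-at-T)))
    where
    j+3-before : ∀ ℓ → F j+2 (suc ℓ) → F j+3 ℓ
    j+3-before = preceded-strictly (uninfluenced-initially (demand₂ y≡1)) (influenced-stable j+3)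
                   (λ ℓ → [ inj₁ ∘ proj₂ ∘ J₁.needs-both (demand₁ x≡0) ℓ , inj₂ ]
                          ∘ J₂.waits-for-one (demand₂ y≡1) ℓ)
    j+3-first : ∀ ℓ → F j+2 ℓ → F j+3 ℓ
    j+3-first = preceded (uninfluenced-initially (demand₂ y≡1)) (influenced-stable j+3) j+3-before

  -- Whichever of j+1, j+2 is influenced first gets its influence from outside the 2-path.
  q≡1⇒left-or-right-feasible₁ : q j+1 ≡ 1 → q j+2 ≡ 1 → FeasibleR T 1 0 j t q ⊎ FeasibleL T 1 j+3 e t q
  q≡1⇒left-or-right-feasible₁ x≡1 y≡1
    with first-cause (influenced? j+1) (influenced? j+2)
           (uninfluenced-initially (demand₁ x≡1)) (uninfluenced-initially (demand₂ y≡1))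
           (J₁.waits-for-one (demand₁ x≡1)) (λ ℓ → swap ∘ J₂.waits-for-one (demand₂ y≡1) ℓ)
           T (inj₁ j+1-at-T)
  ... | s , s<T , inj₁ (j-at-s , ¬j+1-at-s) =
    inj₁ (left-restricted (precedes {s = s} (influenced-stable j+1) (influenced-stable j) j-at-s ¬j+1-at-s)
                          1 (stable-≤ (influenced-stable j) (≤-pred s<T) j-at-s))
  ... | s , s<T , inj₂ (j+3-at-s , ¬j+2-at-s) =
    inj₂ (right-restricted (precedes {s = s} (influenced-stable j+2) (influenced-stable j+3) j+3-at-s ¬j+2-at-s)
                           1 (stable-≤ (influenced-stable j+3) (≤-pred s<T) j+3-at-s))

  module _ {A B C D : ℕ}
    (A-min : ∀ p → FeasibleR T 1 0 j t p → A ≤ cost 0 j p)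
    (B-min : ∀ p → FeasibleL T 2 j+3 e t p → B ≤ cost j+3 e p)
    (C-min : ∀ p → FeasibleR T 2 0 j t p → C ≤ cost 0 j p)
    (D-min : ∀ p → FeasibleL T 1 j+3 e t p → D ≤ cost j+3 e p) where

    lower-bound : suc ((A + B) ⊓ (C + D)) ≤ cost 0 e q
    lower-bound = subst (suc M ≤_) (sym (cost-around q z≤n j+3≤e)) (by-cases (q j+1) (q j+2) refl refl)
      where
      M f g : ℕ
      M = (A + B) ⊓ (C + D)
      f = cost 0 j q
      g = cost j+3 e q

      via-AB : ∀ {e₁ e₂} x y → A ≤ e₁ + f → B ≤ e₂ + g → e₁ + e₂ < x + y → suc M ≤ f + (x + (y + g))
      via-AB {e₁} {e₂} x y A≤ B≤ e<xy =
        ≤-trans (s≤s (m⊓n≤m (A + B) (C + D))) (sum-bound e₁ e₂ f x y g A≤ B≤ e<xy)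

      via-CD : ∀ {e₁ e₂} x y → C ≤ e₁ + f → D ≤ e₂ + g → e₁ + e₂ < x + y → suc M ≤ f + (x + (y + g))
      via-CD {e₁} {e₂} x y C≤ D≤ e<xy =
        ≤-trans (s≤s (m⊓n≤n (A + B) (C + D))) (sum-bound e₁ e₂ f x y g C≤ D≤ e<xy)

      A≤1+f : A ≤ 1 + f
      A≤1+f = ≤-trans (A-min _ (left-raised 1)) (cost-[]≔ {0} j q 1 z≤n)
      B≤1+g : B ≤ 1 + g
      B≤1+g = ≤-trans (B-min _ (right-raised 2)) (cost-[]≔ {j+3} e q 1 ≤-refl)
      C≤1+f : C ≤ 1 + f
      C≤1+f = ≤-trans (C-min _ (left-raised 2)) (cost-[]≔ {0} j q 1 z≤n)
      D≤1+g : D ≤ 1 + g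
      D≤1+g = ≤-trans (D-min _ (right-raised 1)) (cost-[]≔ {j+3} e q 1 ≤-refl)

      by-cases : ∀ x y → q j+1 ≡ x → q j+2 ≡ y → suc M ≤ f + (x + (y + g))
      by-cases 0 0 x≡ y≡ = ⊥-elim (deadlock x≡ y≡)
      by-cases 1 0 x≡ y≡ = via-CD {0} {0} 1 0 (C-min q (q[j+2]≡0⇒left-feasible₂ x≡ y≡))
                                              (D-min q (q[j+2]≡0⇒right-feasible₁ y≡)) ≤-refl
      by-cases 2 0 x≡ y≡ = via-CD {1} {0} 2 0 C≤1+f (D-min q (q[j+2]≡0⇒right-feasible₁ y≡)) (s≤s (s≤s z≤n))
      by-cases 0 1 x≡ y≡ = via-AB {0} {0} 0 1 (A-min q (q[j+1]≡0⇒left-feasible₁ x≡))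
                                              (B-min q (q[j+1]≡0⇒right-feasible₂ x≡ y≡)) ≤-refl
      by-cases 0 2 x≡ y≡ = via-AB {0} {1} 0 2 (A-min q (q[j+1]≡0⇒left-feasible₁ x≡)) B≤1+g (s≤s (s≤s z≤n))
      by-cases 1 1 x≡ y≡ with q≡1⇒left-or-right-feasible₁ x≡ y≡
      ... | inj₁ left  = via-AB {0} {1} 1 1 (A-min q left) B≤1+g ≤-refl
      ... | inj₂ right = via-CD {1} {0} 1 1 C≤1+f (D-min q right) ≤-refl
      by-cases 0 (suc (suc (suc y))) _ _ = via-AB {1} {1} 0 (3 + y) A≤1+f B≤1+g (s≤s (s≤s (s≤s z≤n)))
      by-cases 1 (suc (suc y))       _ _ = via-AB {1} {1} 1 (2 + y) A≤1+f B≤1+g (s≤s (s≤s (s≤s z≤n)))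
      by-cases (suc (suc x)) (suc y) _ _ =
        via-AB {1} {1} (2 + x) (1 + y) A≤1+f B≤1+g (s≤s (s≤s (≤-trans (s≤s z≤n) (m≤n+m (suc y) x))))
      by-cases (suc (suc (suc x))) 0 _ _ = via-AB {1} {1} (3 + x) 0 A≤1+f B≤1+g (s≤s (s≤s (s≤s z≤n)))

splice : (ℕ → ℕ) → ℕ → ℕ → ℕ → (ℕ → ℕ) → ℕ → ℕ
splice p₁ j x y p₂ = ((p₁ ⟨ j ⟩ p₂) [ 1 + j ]≔ x) [ 2 + j ]≔ y

module Splice {e j : ℕ} (p₁ p₂ : ℕ → ℕ) (x y : ℕ) (j+3≤e : 3 + j ≤ e) where

  p : ℕ → ℕ
  p = splice p₁ j x y p₂

  private
    joined raised : ℕ → ℕ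
    joined = p₁ ⟨ j ⟩ p₂
    raised = joined [ 1 + j ]≔ x

  j≤e : j ≤ e
  j≤e = ≤-trans (n≤1+n j) (≤-trans (n≤1+n _) (≤-trans (n≤1+n _) j+3≤e))

  p-left : ∀ {v} → v ≤ j → p v ≡ p₁ v
  p-left v≤j = trans ([]≔-minimal raised y (<⇒≢ (s≤s (m≤n⇒m≤1+n v≤j))))
                 (trans ([]≔-minimal joined x (<⇒≢ (s≤s v≤j))) (⟨⟩-left p₁ p₂ v≤j))

  p[j+1] : p (1 + j) ≡ x
  p[j+1] = trans ([]≔-minimal raised y {1 + j} (<⇒≢ ≤-refl)) ([]≔-updates joined (1 + j) x)

  p[j+2] : p (2 + j) ≡ y
  p[j+2] = []≔-updates raised (2 + j) y

  p-right : ∀ {v} → 3 + j ≤ v → p v ≡ p₂ v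
  p-right j+3≤v = trans ([]≔-minimal raised y (>⇒≢ j+3≤v))
                    (trans ([]≔-minimal joined x (>⇒≢ (≤-trans (n≤1+n _) j+3≤v)))
                      (⟨⟩-right p₁ p₂ (≤-trans (n≤1+n _) (≤-trans (n≤1+n _) j+3≤v))))

  positions : ∀ v → v ≤ j ⊎ v ≡ 1 + j ⊎ v ≡ 2 + j ⊎ 3 + j ≤ v
  positions v with v ≤? j | v ≟ 1 + j | v ≟ 2 + j
  ... | yes v≤j | _          | _          = inj₁ v≤j
  ... | no _    | yes v≡j+1  | _          = inj₂ (inj₁ v≡j+1)
  ... | no _    | no _       | yes v≡j+2  = inj₂ (inj₂ (inj₁ v≡j+2))
  ... | no v≰j  | no v≢j+1   | no v≢j+2   =
    inj₂ (inj₂ (inj₂ (≤∧≢⇒< (≤∧≢⇒< (≰⇒> v≰j) (v≢j+1 ∘ sym)) (v≢j+2 ∘ sym))))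

  cost-splice : cost 0 e p ≡ cost 0 j p₁ + (x + (y + cost (3 + j) e p₂))
  cost-splice = trans (cost-around p z≤n j+3≤e)
    (cong₂ _+_ (cost-cong 0 j λ v _ v≤j → p-left v≤j)
      (cong₂ _+_ p[j+1] (cong₂ _+_ p[j+2] (cost-cong (3 + j) e λ v j+3≤v _ → p-right j+3≤v))))

  module FromParts {T′ : ℕ} {t : ℕ → ℕ} (x≤t : x ≤ t (1 + j)) (y≤t : y ≤ t (2 + j))
           (p₁-feasible : Feasible (2 + T′) 0 j t p₁) (p₂-feasible : Feasible (2 + T′) (3 + j) e t p₂) where

    T : ℕ
    T = 2 + T′

    G : ℕ → ℕ → Set
    G = Influenced 0 e t p

    p≤t : ∀ v → v ≤ e → p v ≤ t v
    p≤t v v≤e with positions v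
    ... | inj₁ v≤j                 = subst (_≤ t v) (sym (p-left v≤j)) (proj₁ p₁-feasible v z≤n v≤j)
    ... | inj₂ (inj₁ refl)         = subst (_≤ t v) (sym p[j+1]) x≤t
    ... | inj₂ (inj₂ (inj₁ refl))  = subst (_≤ t v) (sym p[j+2]) y≤t
    ... | inj₂ (inj₂ (inj₂ j+3≤v)) = subst (_≤ t v) (sym (p-right j+3≤v)) (proj₁ p₂-feasible v j+3≤v v≤e)

    from-left : ∀ ℓ v → v ≤ j → Influenced 0 j t p₁ v ℓ → G v ℓ
    from-left ℓ v = embedding t z≤n j≤e (λ v _ v≤j → ≤-reflexive (sym (p-left v≤j)))
                      (λ v _ v≤j → p≤t v (≤-trans v≤j j≤e)) ℓ v z≤n

    from-right : ∀ ℓ v → 3 + j ≤ v → v ≤ e → Influenced (3 + j) e t p₂ v ℓ → G v ℓ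
    from-right = embedding t z≤n ≤-refl (λ v j+3≤v _ → ≤-reflexive (sym (p-right j+3≤v))) (λ v _ → p≤t v)

    influenced-everywhere : ∀ {ℓ} → (∀ v → v ≤ j → Influenced 0 j t p₁ v ℓ) →
      (∀ v → 3 + j ≤ v → v ≤ e → Influenced (3 + j) e t p₂ v ℓ) →
      G (1 + j) ℓ → G (2 + j) ℓ → ∀ v → v ≤ e → G v ℓ
    influenced-everywhere {ℓ} left right j+1-at-ℓ j+2-at-ℓ v v≤e with positions v
    ... | inj₁ v≤j                 = from-left ℓ v v≤j (left v v≤j)
    ... | inj₂ (inj₁ refl)         = j+1-at-ℓ
    ... | inj₂ (inj₂ (inj₁ refl))  = j+2-at-ℓ
    ... | inj₂ (inj₂ (inj₂ j+3≤v)) = from-right ℓ v j+3≤v v≤e (right v j+3≤v v≤e)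

    feasible : G (1 + j) T → G (2 + j) T → Feasible T 0 e t p
    feasible j+1-at-T j+2-at-T =
      (λ v _ → p≤t v) ,
      λ v _ → influenced-everywhere {T} (λ v → proj₂ p₁-feasible v z≤n) (proj₂ p₂-feasible)
                                         j+1-at-T j+2-at-T v

module _ {T′ e j : ℕ} {t : ℕ → ℕ} (t[j+1]≡2 : t (1 + j) ≡ 2) (t[j+2]≡2 : t (2 + j) ≡ 2)
         (j+3≤e : 3 + j ≤ e) where

  private
    1≤t : ∀ {v} → t v ≡ 2 → 1 ≤ t v
    1≤t t≡2 = ≤-trans (s≤s z≤n) (≤-reflexive (sym t≡2))

    j+1<e : 1 + j < e
    j+1<e = ≤-trans (n≤1+n _) j+3≤e

  splice-feasible₁₂ : ∀ p₁ p₂ → FeasibleR (2 + T′) 1 0 j t p₁ → FeasibleL (2 + T′) 2 (3 + j) e t p₂ →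
                      Feasible (2 + T′) 0 e t (splice p₁ j 0 1 p₂)
  splice-feasible₁₂ p₁ p₂ (p₁-feasible , j-early) (p₂-feasible , j+3-early) =
    feasible j+1-at-T (influenced-stable (2 + j) (suc T′) j+2-early)
    where
    open Splice p₁ p₂ 0 1 j+3≤e
    open FromParts {T′} z≤n (1≤t t[j+2]≡2) p₁-feasible p₂-feasible
    open Process 0 e t p
    j+2-early : G (2 + j) (suc T′)
    j+2-early = Interior.one-neighbour-suffices {2 + j} (s≤s z≤n) j+3≤e
                  (≤-reflexive (cong₂ _∸_ t[j+2]≡2 p[j+2])) T′
                  (inj₂ (from-right T′ (3 + j) ≤-refl j+3≤e j+3-early))
    j+1-at-T : G (1 + j) T
    j+1-at-T = Interior.both-neighbours-suffice {1 + j} (s≤s z≤n) j+1<e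
                 (≤-reflexive (cong₂ _∸_ t[j+1]≡2 p[j+1])) (suc T′)
                 (from-left (suc T′) j ≤-refl j-early) j+2-early

  splice-feasible₂₁ : ∀ p₁ p₂ → FeasibleR (2 + T′) 2 0 j t p₁ → FeasibleL (2 + T′) 1 (3 + j) e t p₂ →
                      Feasible (2 + T′) 0 e t (splice p₁ j 1 0 p₂)
  splice-feasible₂₁ p₁ p₂ (p₁-feasible , j-early) (p₂-feasible , j+3-early) =
    feasible (influenced-stable (1 + j) (suc T′) j+1-early) j+2-at-T
    where
    open Splice p₁ p₂ 1 0 j+3≤e
    open FromParts {T′} (1≤t t[j+1]≡2) z≤n p₁-feasible p₂-feasible
    open Process 0 e t p
    j+1-early : G (1 + j) (suc T′)
    j+1-early = Interior.one-neighbour-suffices {1 + j} (s≤s z≤n) j+1<e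
                  (≤-reflexive (cong₂ _∸_ t[j+1]≡2 p[j+1])) T′
                  (inj₁ (from-left T′ j ≤-refl j-early))
    j+2-at-T : G (2 + j) T
    j+2-at-T = Interior.both-neighbours-suffice {2 + j} (s≤s z≤n) j+3≤e
                 (≤-reflexive (cong₂ _∸_ t[j+2]≡2 p[j+2])) (suc T′)
                 j+1-early (from-right (suc T′) (3 + j) ≤-refl j+3≤e j+3-early)


two-path-OPT : ∀ {T′ e j} {t : ℕ → ℕ} {a b c d} →
  t j ≡ 1 → t (1 + j) ≡ 2 → t (2 + j) ≡ 2 → t (3 + j) ≡ 1 → 3 + j ≤ e →
  OPT→ (2 + T′) 0 j 1 t a → OPT← (2 + T′) 2 (3 + j) e t b →
  OPT→ (2 + T′) 0 j 2 t c → OPT← (2 + T′) 1 (3 + j) e t d →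
  OPT (2 + T′) 0 e t (1 + ((a + b) ⊓ (c + d)))
two-path-OPT {T′} {e} {j} {t} {a} {b} {c} {d} t[j] t[j+1] t[j+2] t[j+3] j+3≤e
             ((p₁ , p₁-feasible , p₁-cost) , a-min) ((p₂ , p₂-feasible , p₂-cost) , b-min)
             ((p₃ , p₃-feasible , p₃-cost) , c-min) ((p₄ , p₄-feasible , p₄-cost) , d-min) =
  optimum ,
  λ q q-feasible →
    LowerBound.lower-bound {T′} t[j] t[j+1] t[j+2] t[j+3] j+3≤e q-feasible a-min b-min c-min d-min
  where
  open ≡-Reasoning
  optimum : Σ[ p ∈ (ℕ → ℕ) ] Feasible (2 + T′) 0 e t p × cost 0 e p ≡ 1 + ((a + b) ⊓ (c + d))
  optimum with a + b ≤? c + d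
  ... | yes ab≤cd =
    splice p₁ j 0 1 p₂ , splice-feasible₁₂ {T′} t[j+1] t[j+2] j+3≤e p₁ p₂ p₁-feasible p₂-feasible , (begin
      cost 0 e (splice p₁ j 0 1 p₂)                ≡⟨ Splice.cost-splice p₁ p₂ 0 1 j+3≤e ⟩
      cost 0 j p₁ + (0 + (1 + cost (3 + j) e p₂))  ≡⟨ cong₂ (λ u w → u + suc w) p₁-cost p₂-cost ⟩
      a + suc b                                    ≡⟨ +-suc a b ⟩
      1 + (a + b)                                  ≡⟨ cong suc (m≤n⇒m⊓n≡m ab≤cd) ⟨
      1 + ((a + b) ⊓ (c + d))                      ∎)
  ... | no ab≰cd =
    splice p₃ j 1 0 p₄ , splice-feasible₂₁ {T′} t[j+1] t[j+2] j+3≤e p₃ p₄ p₃-feasible p₄-feasible , (begin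
      cost 0 e (splice p₃ j 1 0 p₄)                ≡⟨ Splice.cost-splice p₃ p₄ 1 0 j+3≤e ⟩
      cost 0 j p₃ + (1 + (0 + cost (3 + j) e p₄))  ≡⟨ cong₂ (λ u w → u + suc w) p₃-cost p₄-cost ⟩
      c + suc d                                    ≡⟨ +-suc c d ⟩
      1 + (c + d)                                  ≡⟨ cong suc (m≥n⇒m⊓n≡n (<⇒≤ (≰⇒> ab≰cd))) ⟨
      1 + ((a + b) ⊓ (c + d))                      ∎)

lemma4 : (T n j : ℕ) (t : ℕ → ℕ) →
    1 < T →
    j + 4 ≤ n →
    t 0 ≡ 1 → t (n ∸ 1) ≡ 1 →
    (∀ i → 1 ≤ i → i ≤ n ∸ 2 → t i ≡ 1 ⊎ t i ≡ 2) →
    (∀ i → i < j → t i ≡ 1) →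
    t j ≡ 1 → t (j + 1) ≡ 2 → t (j + 2) ≡ 2 → t (j + 3) ≡ 1 →
    (a b c d : ℕ) →
    OPT→ T 0 j 1 t a → OPT← T 2 (j + 3) (n ∸ 1) t b →
    OPT→ T 0 j 2 t c → OPT← T 1 (j + 3) (n ∸ 1) t d →
    OPT T 0 (n ∸ 1) t (1 + ((a + b) ⊓ (c + d)))
lemma4 T@(suc (suc T′)) n j t (s≤s (s≤s _)) j+4≤n _ _ _ _ t[j] t[j+1] t[j+2] t[j+3] a b c d
       opt-a opt-b opt-c opt-d =
  two-path-OPT {T′} {n ∸ 1} {j} {t} {a} {b} {c} {d}
    t[j] (commute (λ k → t k ≡ 2) 1 t[j+1]) (commute (λ k → t k ≡ 2) 2 t[j+2])
    (commute (λ k → t k ≡ 1) 3 t[j+3]) (∸-monoˡ-≤ 1 (commute (_≤ n) 4 j+4≤n))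
    opt-a (commute (λ k → OPT← T 2 k (n ∸ 1) t b) 3 opt-b)
    opt-c (commute (λ k → OPT← T 1 k (n ∸ 1) t d) 3 opt-d)
  where
  commute : (P : ℕ → Set) (k : ℕ) → P (j + k) → P (k + j)
  commute P k = subst P (+-comm j k)
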